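{- Let $q$ be a prime power and let $n$ be an odd positive integer. Then every subspace code $\mathcal{C}$ in $\mathbb{F}_q^n$ whose minimum subspace distance is at least $n$ contains at most two codewords; that is, $A_q(n,n)\le 2$.
   Context: A subspace code $\mathcal{C}$ in $\mathbb{F}_q^n$ is a set of $\mathbb{F}_q$-linear subspaces of $\mathbb{F}_q^n$ (of arbitrary, possibly different, dimensions). The subspace distance of subspaces $U,W$ is $d_S(U,W)=\dim(U+W)-\dim(U\cap W)$, and the minimum distance of $\mathcal{C}$ is $\min\{d_S(U,W): U,W\in\mathcal{C},\,U\neq W\}$. $A_q(n,d)$ denotes the maximum cardinality of a subspace code in $\mathbb{F}_q^n$ with minimum subspace distance at least $d$. -}

module Defs where

open import Level using (0ℓ)
open import Algebra.Bundles using (CommutativeRing)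
open import Data.Nat using (ℕ; zero; suc; _^_; _≤_)
import Data.Nat as ℕ
open import Data.Nat.Primality using (Prime)
open import Data.Fin using (Fin)
import Data.Fin as Fin
open import Data.Product using (Σ; ∃; ∃-syntax; _×_; _,_)
open import Relation.Nullary using (¬_)
open import Relation.Binary.PropositionalEquality using (_≡_)

IsPrimePower : ℕ → Set
IsPrimePower q = ∃[ p ] ∃[ k ] (Prime p × q ≡ p ^ suc k)

record FiniteField (q : ℕ) : Set₁ where
  field
    commRing : CommutativeRing 0ℓ 0ℓ
  open CommutativeRing commRing public
  field
    0≉1     : ¬ (0# ≈ 1#)
    inverse : ∀ x → ¬ (x ≈ 0#) → ∃[ y ] (x * y ≈ 1#)
    enum    : Fin q → Carrier
    enum-injective  : ∀ i j → enum i ≈ enum j → i ≡ j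
    enum-surjective : ∀ x → ∃[ i ] (enum i ≈ x)

module LinearAlgebra {q : ℕ} (F : FiniteField q) (n : ℕ) where
  open FiniteField F using (Carrier; _≈_; _+_; _*_; 0#)

  Vect : Set
  Vect = Fin n → Carrier

  _≈ᵥ_ : Vect → Vect → Set
  u ≈ᵥ v = ∀ i → u i ≈ v i

  0ᵥ : Vect
  0ᵥ _ = 0#

  _+ᵥ_ : Vect → Vect → Vect
  (u +ᵥ v) i = u i + v i

  _·ᵥ_ : Carrier → Vect → Vect
  (c ·ᵥ v) i = c * v i

  sumF : (k : ℕ) → (Fin k → Carrier) → Carrier
  sumF zero    f = 0#
  sumF (suc k) f = f Fin.zero + sumF k (λ j → f (Fin.suc j))

  lincomb : {k : ℕ} → (Fin k → Carrier) → (Fin k → Vect) → Vect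
  lincomb {k} c vs i = sumF k (λ j → c j * vs j i)

  Pred : Set₁
  Pred = Vect → Set

  record Subspace : Set₁ where
    field
      carrier  : Pred
      resp     : ∀ {u v} → u ≈ᵥ v → carrier u → carrier v
      has-zero : carrier 0ᵥ
      closed-+ : ∀ {u v} → carrier u → carrier v → carrier (u +ᵥ v)
      closed-· : ∀ c {v} → carrier v → carrier (c ·ᵥ v)
  open Subspace public

  record IsBasis (U : Pred) {k : ℕ} (vs : Fin k → Vect) : Set where
    field
      members     : ∀ j → U (vs j)
      independent : ∀ c → lincomb c vs ≈ᵥ 0ᵥ → ∀ j → c j ≈ 0#
      spanning    : ∀ v → U v → ∃[ c ] (v ≈ᵥ lincomb c vs)

  HasDim : Pred → ℕ → Set
  HasDim U k = ∃[ vs ] IsBasis U {k} vs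

  _∩ₚ_ : Pred → Pred → Pred
  (U ∩ₚ W) v = U v × W v

  _+ₚ_ : Pred → Pred → Pred
  (U +ₚ W) v = ∃[ u ] ∃[ w ] (U u × W w × v ≈ᵥ (u +ᵥ w))

  SameSpace : Subspace → Subspace → Set
  SameSpace U W = ∀ v → (carrier U v → carrier W v) × (carrier W v → carrier U v)

  -- d_S(U,W) = dim(U+W) - dim(U∩W) is at least d
  DistAtLeast : ℕ → Subspace → Subspace → Set
  DistAtLeast d U W = ∀ a b → HasDim (carrier U +ₚ carrier W) a
                            → HasDim (carrier U ∩ₚ carrier W) b → d ℕ.+ b ≤ a

  record SubspaceCode (m d : ℕ) : Set₁ where
    field
      word     : Fin m → Subspace
      distinct : ∀ i j → ¬ (i ≡ j) → ¬ SameSpace (word i) (word j)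
      min-dist : ∀ i j → ¬ (i ≡ j) → DistAtLeast d (word i) (word j)

-- A code of minimum distance at least n forces, for any two codewords U and W,
-- dim(U ∩ W) = 0 and dim(U + W) = n (as U + W ⊆ F_q^n), hence dim U + dim W = n.
-- Three codewords would then all have dimension n / 2, impossible for odd n.
-- Constructively, a subspace has a dimension only up to double negation: a basis is
-- grown one vector at a time (membership in a span is decidable since F_q is finite,
-- and Gaussian elimination bounds independent families by n); this suffices because
-- the conclusion m ≤ 2 is decidable.

module Submission where

open import Defs
open import Data.Nat using (ℕ; zero; suc; _≤_; _<_; z≤n; s≤s)
import Data.Nat as ℕ
import Data.Nat.Properties as ℕ
open import Data.Fin using (Fin; zero; suc; punchIn; _↑ˡ_; _↑ʳ_; splitAt; join)
import Data.Fin as Fin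
open import Data.Fin.Properties using (any?; all?; join-splitAt)
open import Data.Vec.Functional using (Vector; _∷_; tail; insertAt; _++_)
open import Data.Vec.Functional.Properties using (insertAt-punchIn; insertAt-lookup; lookup-++ˡ; lookup-++ʳ)
open import Data.Product using (∃; ∃-syntax; _×_; _,_; proj₂)
open import Data.Sum using (inj₁; inj₂)
open import Function using (_∘_; id)
open import Relation.Nullary using (¬_; Dec; yes; no)
open import Relation.Nullary.Decidable using (map′; ¬?; decidable-stable; ¬¬-excluded-middle)
open import Relation.Nullary.Negation using (contradiction; ¬¬-Monad)
open import Effect.Monad using (RawMonad)
open import Relation.Binary.PropositionalEquality using (_≡_)
import Relation.Binary.PropositionalEquality as ≡

∀-splitAt : ∀ m {n} {P : Fin (m ℕ.+ n) → Set} →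
            (∀ i → P (i ↑ˡ n)) → (∀ j → P (m ↑ʳ j)) → ∀ i → P i
∀-splitAt m {n} {P} left right i = ≡.subst P (join-splitAt m n i) (joined (splitAt m i))
  where
  joined : ∀ s → P (join m n s)
  joined (inj₁ i) = left i
  joined (inj₂ j) = right j

pairwise-sums⇒double : ∀ a b c {n} → a ℕ.+ b ≡ n → a ℕ.+ c ≡ n → b ℕ.+ c ≡ n → 2 ℕ.* a ≡ n
pairwise-sums⇒double a b c a+b≡n a+c≡n b+c≡n = begin
  a ℕ.+ (a ℕ.+ 0)  ≡⟨ ≡.cong (a ℕ.+_) (ℕ.+-identityʳ a) ⟩
  a ℕ.+ a          ≡⟨ ≡.cong (a ℕ.+_) (ℕ.+-cancelʳ-≡ c a b (≡.trans a+c≡n (≡.sym b+c≡n))) ⟩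
  a ℕ.+ b          ≡⟨ a+b≡n ⟩
  _                ∎
  where open ≡.≡-Reasoning

module _ {q : ℕ} (F : FiniteField q) where
  open FiniteField F hiding (zero)
  open import Algebra.Properties.Semiring.Sum semiring
    using (sum; sum-cong-≋; sum-cong-≗; sum-remove; ∑-distrib-+; *-distribˡ-sum; *-distribʳ-sum; sum-replicate-zero)
  open import Algebra.Properties.Ring ring using (-‿distribˡ-*; -‿distribʳ-*; -1*x≈-x; +-inverseˡ-unique)
  open import Relation.Binary.Reasoning.Setoid setoid
  open module LA {n : ℕ} = LinearAlgebra F n

  _≈?_ : (x y : Carrier) → Dec (x ≈ y)
  x ≈? y with enum-surjective x | enum-surjective y
  ... | i , i↦x | j , j↦y =
    map′ (λ i≡j → trans (sym i↦x) (trans (reflexive (≡.cong enum i≡j)) j↦y))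
         (λ x≈y → enum-injective i j (trans i↦x (trans x≈y (sym j↦y))))
         (i Fin.≟ j)

  ∃? : {P : Carrier → Set} → (∀ {x y} → x ≈ y → P x → P y) → (∀ x → Dec (P x)) → Dec (∃ P)
  ∃? resp P? =
    map′ (λ (i , p) → enum i , p)
         (λ (x , p) → let (i , i↦x) = enum-surjective x in i , resp (sym i↦x) p)
         (any? (P? ∘ enum))

  ∃-vector? : ∀ k {P : Vector Carrier k → Set} →
              (∀ {c c′} → c ≈ᵥ c′ → P c → P c′) → (∀ c → Dec (P c)) → Dec (∃ P)
  ∃-vector? zero resp P? = map′ (λ p → _ , p) (λ (c , p) → resp (λ ()) p) (P? (λ ()))
  ∃-vector? (suc k) {P} resp P? =
    map′ (λ (x , c , p) → x ∷ c , p)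
         (λ (c , p) → c zero , tail c , resp (λ { zero → refl ; (suc j) → refl }) p)
         (∃? (λ x≈y (c , p) → c , resp (λ { zero → x≈y ; (suc j) → refl }) p)
             (λ x → ∃-vector? k (λ c≈c′ → resp (λ { zero → refl ; (suc j) → c≈c′ j }))
                                (λ c → P? (x ∷ c))))

  lincomb≡sum : ∀ {n k} (c : Vector Carrier k) (vs : Vector (Vect {n}) k) i →
                lincomb c vs i ≡ sum (λ j → c j * vs j i)
  lincomb≡sum {k = zero}  c vs i = ≡.refl
  lincomb≡sum {k = suc k} c vs i = ≡.cong (c zero * vs zero i +_) (lincomb≡sum (tail c) (tail vs) i)

  -- Not definitional: sumF carries the parameter n of LinearAlgebra.
  lincomb-tail : ∀ {n k} (c : Vector Carrier k) (vs : Vector (Vect {suc n}) k) i →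
                 lincomb c vs (suc i) ≡ lincomb c (tail ∘ vs) i
  lincomb-tail c vs i = ≡.trans (lincomb≡sum c vs (suc i)) (≡.sym (lincomb≡sum c (tail ∘ vs) i))

  lincomb-congˡ : ∀ {n k} {c c′ : Vector Carrier k} (vs : Vector (Vect {n}) k) →
                  c ≈ᵥ c′ → lincomb c vs ≈ᵥ lincomb c′ vs
  lincomb-congˡ {c = c} {c′} vs c≈c′ i = begin
    lincomb c vs i            ≡⟨ lincomb≡sum c vs i ⟩
    sum (λ j → c j * vs j i)  ≈⟨ sum-cong-≋ (λ j → *-congʳ (c≈c′ j)) ⟩
    sum (λ j → c′ j * vs j i) ≡⟨ lincomb≡sum c′ vs i ⟨
    lincomb c′ vs i           ∎

  lincomb-+ᵥ : ∀ {n k} (c : Vector Carrier k) (us ws : Vector (Vect {n}) k) →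
               lincomb c (λ j → us j +ᵥ ws j) ≈ᵥ (lincomb c us +ᵥ lincomb c ws)
  lincomb-+ᵥ c us ws i = begin
    lincomb c (λ j → us j +ᵥ ws j) i                          ≡⟨ lincomb≡sum c (λ j → us j +ᵥ ws j) i ⟩
    sum (λ j → c j * (us j i + ws j i))                       ≈⟨ sum-cong-≋ (λ j → distribˡ (c j) _ _) ⟩
    sum (λ j → c j * us j i + c j * ws j i)                   ≈⟨ ∑-distrib-+ (λ j → c j * us j i) (λ j → c j * ws j i) ⟩
    sum (λ j → c j * us j i) + sum (λ j → c j * ws j i)       ≡⟨ ≡.cong₂ _+_ (lincomb≡sum c us i) (lincomb≡sum c ws i) ⟨
    lincomb c us i + lincomb c ws i                           ∎

  lincomb-multiples : ∀ {n k} (c a : Vector Carrier k) (v : Vect {n}) →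
                      lincomb c (λ j → a j ·ᵥ v) ≈ᵥ (sum (λ j → c j * a j) ·ᵥ v)
  lincomb-multiples c a v i = begin
    lincomb c (λ j → a j ·ᵥ v) i      ≡⟨ lincomb≡sum c (λ j → a j ·ᵥ v) i ⟩
    sum (λ j → c j * (a j * v i))     ≈⟨ sum-cong-≋ (λ j → *-assoc (c j) (a j) (v i)) ⟨
    sum (λ j → c j * a j * v i)       ≈⟨ *-distribʳ-sum (v i) (λ j → c j * a j) ⟨
    sum (λ j → c j * a j) * v i       ∎

  lincomb-scale : ∀ {n k} (a : Carrier) (c : Vector Carrier k) (vs : Vector (Vect {n}) k) →
                  lincomb (λ j → a * c j) vs ≈ᵥ (a ·ᵥ lincomb c vs)
  lincomb-scale a c vs i = begin
    lincomb (λ j → a * c j) vs i      ≡⟨ lincomb≡sum (λ j → a * c j) vs i ⟩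
    sum (λ j → a * c j * vs j i)      ≈⟨ sum-cong-≋ (λ j → *-assoc a (c j) (vs j i)) ⟩
    sum (λ j → a * (c j * vs j i))    ≈⟨ *-distribˡ-sum a (λ j → c j * vs j i) ⟨
    a * sum (λ j → c j * vs j i)      ≡⟨ ≡.cong (a *_) (lincomb≡sum c vs i) ⟨
    a * lincomb c vs i                ∎

  lincomb-insertAt : ∀ {n k} (c : Vector Carrier k) (p : Fin (suc k)) (μ : Carrier)
                     (vs : Vector (Vect {n}) (suc k)) →
                     lincomb (insertAt c p μ) vs ≈ᵥ ((μ ·ᵥ vs p) +ᵥ lincomb c (vs ∘ punchIn p))
  lincomb-insertAt c p μ vs i = begin
    lincomb (insertAt c p μ) vs i                                   ≡⟨ lincomb≡sum (insertAt c p μ) vs i ⟩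
    sum (λ j → insertAt c p μ j * vs j i)                           ≈⟨ sum-remove {i = p} (λ j → insertAt c p μ j * vs j i) ⟩
    insertAt c p μ p * vs p i
      + sum (λ j → insertAt c p μ (punchIn p j) * vs (punchIn p j) i)
        ≈⟨ +-cong (*-congʳ (reflexive (insertAt-lookup c p μ)))
                  (sum-cong-≋ (λ j → *-congʳ (reflexive (insertAt-punchIn c p μ j)))) ⟩
    μ * vs p i + sum (λ j → c j * vs (punchIn p j) i)               ≡⟨ ≡.cong (μ * vs p i +_) (lincomb≡sum c (vs ∘ punchIn p) i) ⟨
    μ * vs p i + lincomb c (vs ∘ punchIn p) i                       ∎

  lincomb-zero-coordinate : ∀ {n k} (c : Vector Carrier k) (vs : Vector (Vect {n}) k) i →
                            (∀ j → vs j i ≈ 0#) → lincomb c vs i ≈ 0#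
  lincomb-zero-coordinate {k = k} c vs i zeros = begin
    lincomb c vs i               ≡⟨ lincomb≡sum c vs i ⟩
    sum (λ j → c j * vs j i)     ≈⟨ sum-cong-≋ (λ j → trans (*-congˡ (zeros j)) (zeroʳ (c j))) ⟩
    sum {k} (λ _ → 0#)           ≈⟨ sum-replicate-zero k ⟩
    0#                           ∎

  sum-splitAt : ∀ m {n} (f : Vector Carrier (m ℕ.+ n)) →
                sum f ≈ sum (f ∘ (_↑ˡ n)) + sum (f ∘ (m ↑ʳ_))
  sum-splitAt zero    f = sym (+-identityˡ (sum f))
  sum-splitAt (suc m) f = trans (+-congˡ (sum-splitAt m (tail f))) (sym (+-assoc _ _ _))

  lincomb-++ : ∀ {n a b} (c : Vector Carrier (a ℕ.+ b)) (us : Vector (Vect {n}) a) (ws : Vector Vect b) →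
               lincomb c (us ++ ws) ≈ᵥ (lincomb (c ∘ (_↑ˡ b)) us +ᵥ lincomb (c ∘ (a ↑ʳ_)) ws)
  lincomb-++ {a = a} {b} c us ws i = begin
    lincomb c (us ++ ws) i
      ≡⟨ lincomb≡sum c (us ++ ws) i ⟩
    sum (λ j → c j * (us ++ ws) j i)
      ≈⟨ sum-splitAt a (λ j → c j * (us ++ ws) j i) ⟩
    sum (λ j → c (j ↑ˡ b) * (us ++ ws) (j ↑ˡ b) i) + sum (λ j → c (a ↑ʳ j) * (us ++ ws) (a ↑ʳ j) i)
      ≡⟨ ≡.cong₂ _+_ (sum-cong-≗ (λ j → ≡.cong (λ u → c (j ↑ˡ b) * u i) (lookup-++ˡ us ws j)))
                     (sum-cong-≗ (λ j → ≡.cong (λ w → c (a ↑ʳ j) * w i) (lookup-++ʳ us ws j))) ⟩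
    sum (λ j → c (j ↑ˡ b) * us j i) + sum (λ j → c (a ↑ʳ j) * ws j i)
      ≡⟨ ≡.cong₂ _+_ (lincomb≡sum (c ∘ (_↑ˡ b)) us i) (lincomb≡sum (c ∘ (a ↑ʳ_)) ws i) ⟨
    lincomb (c ∘ (_↑ˡ b)) us i + lincomb (c ∘ (a ↑ʳ_)) ws i
      ∎

  Independent : ∀ {n k} → Vector (Vect {n}) k → Set
  Independent vs = ∀ c → lincomb c vs ≈ᵥ 0ᵥ → ∀ j → c j ≈ 0#

  Span : ∀ {n k} → Vector (Vect {n}) k → Pred {n}
  Span vs v = ∃[ c ] (v ≈ᵥ lincomb c vs)

  shear : ∀ {n k} (p : Fin (suc k)) (a : Vector Carrier k) →
          Vector (Vect {n}) (suc k) → Vector (Vect {n}) k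
  shear p a vs j = vs (punchIn p j) +ᵥ (a j ·ᵥ vs p)

  independent-shear : ∀ {n k} (p : Fin (suc k)) (a : Vector Carrier k) (vs : Vector (Vect {n}) (suc k)) →
                      Independent vs → Independent (shear p a vs)
  independent-shear p a vs ind c combination≈0 j = begin
    c j                           ≡⟨ insertAt-punchIn c p μ j ⟨
    insertAt c p μ (punchIn p j)  ≈⟨ ind (insertAt c p μ) lifted≈0 (punchIn p j) ⟩
    0#                            ∎
    where
    μ : Carrier
    μ = sum (λ j → c j * a j)

    lifted≈0 : lincomb (insertAt c p μ) vs ≈ᵥ 0ᵥ
    lifted≈0 i = begin
      lincomb (insertAt c p μ) vs i                                   ≈⟨ lincomb-insertAt c p μ vs i ⟩
      μ * vs p i + lincomb c (vs ∘ punchIn p) i                       ≈⟨ +-comm _ _ ⟩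
      lincomb c (vs ∘ punchIn p) i + μ * vs p i                       ≈⟨ +-congˡ (lincomb-multiples c a (vs p) i) ⟨
      lincomb c (vs ∘ punchIn p) i + lincomb c (λ j → a j ·ᵥ vs p) i  ≈⟨ lincomb-+ᵥ c (vs ∘ punchIn p) (λ j → a j ·ᵥ vs p) i ⟨
      lincomb c (shear p a vs) i                                      ≈⟨ combination≈0 i ⟩
      0#                                                              ∎

  shear-clears-column : ∀ {n k} (p : Fin (suc k)) (vs : Vector (Vect {suc n}) (suc k)) {β : Carrier} →
                        vs p zero * β ≈ 1# →
                        ∀ j → shear p (λ j → - (vs (punchIn p j) zero * β)) vs j zero ≈ 0#
  shear-clears-column p vs {β} αβ≈1 j = begin
    x + - (x * β) * α    ≈⟨ +-congˡ (-‿distribˡ-* (x * β) α) ⟨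
    x + - (x * β * α)    ≈⟨ +-congˡ (-‿cong (*-assoc x β α)) ⟩
    x + - (x * (β * α))  ≈⟨ +-congˡ (-‿cong (*-congˡ (trans (*-comm β α) αβ≈1))) ⟩
    x + - (x * 1#)       ≈⟨ +-congˡ (-‿cong (*-identityʳ x)) ⟩
    x + - x              ≈⟨ -‿inverseʳ x ⟩
    0#                   ∎
    where
    x α : Carrier
    x = vs (punchIn p j) zero
    α = vs p zero

  independent-tails : ∀ {n k} (vs : Vector (Vect {suc n}) k) →
                      (∀ j → vs j zero ≈ 0#) → Independent vs → Independent (tail ∘ vs)
  independent-tails vs zeros ind c tails≈0 = ind c λ where
    zero    → lincomb-zero-coordinate c vs zero zeros
    (suc i) → trans (reflexive (lincomb-tail c vs i)) (tails≈0 i)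

  independent⇒≤ : ∀ {n k} (vs : Vector (Vect {n}) k) → Independent vs → k ≤ n
  independent⇒≤ {zero}  {zero}  _ _   = z≤n
  independent⇒≤ {zero}  {suc k} _ ind = contradiction (sym (ind (λ _ → 1#) (λ ()) zero)) 0≉1
  independent⇒≤ {suc n} {zero}  _ _   = z≤n
  independent⇒≤ {suc n} {suc k} vs ind with any? (λ p → ¬? (vs p zero ≈? 0#))
  ... | no no-pivot = ℕ.m≤n⇒m≤1+n (independent⇒≤ (tail ∘ vs) (independent-tails vs first-column-zero ind))
    where
    first-column-zero : ∀ j → vs j zero ≈ 0#
    first-column-zero j = decidable-stable (vs j zero ≈? 0#) (λ α≉0 → no-pivot (j , α≉0))
  ... | yes (p , α≉0) with inverse (vs p zero) α≉0
  ...   | β , αβ≈1 =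
    s≤s (independent⇒≤ (tail ∘ cleared) (independent-tails cleared (shear-clears-column p vs αβ≈1) (independent-shear p a vs ind)))
    where
    a : Vector Carrier k
    a j = - (vs (punchIn p j) zero * β)

    cleared : Vector Vect k
    cleared = shear p a vs

  span? : ∀ {n k} (vs : Vector (Vect {n}) k) v → Dec (Span vs v)
  span? {k = k} vs v =
    ∃-vector? k (λ c≈c′ v≈ i → trans (v≈ i) (lincomb-congˡ vs c≈c′ i))
                (λ c → all? (λ i → v i ≈? lincomb c vs i))

  independent-∷ : ∀ {n k} (v : Vect {n}) (vs : Vector Vect k) →
                  ¬ Span vs v → Independent vs → Independent (v ∷ vs)
  independent-∷ v vs v∉span ind c combination≈0 = λ where
      zero    → c₀≈0
      (suc j) → ind (tail c) rest≈0 j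
    where
    L : Vect
    L = lincomb (tail c) vs

    solve-for-v : ∀ {β} → β * c zero ≈ 1# → v ≈ᵥ lincomb (λ j → - β * c (suc j)) vs
    solve-for-v {β} βc₀≈1 i = begin
      v i                   ≈⟨ *-identityˡ (v i) ⟨
      1# * v i              ≈⟨ *-congʳ βc₀≈1 ⟨
      β * c zero * v i      ≈⟨ *-assoc β (c zero) (v i) ⟩
      β * (c zero * v i)    ≈⟨ *-congˡ (+-inverseˡ-unique _ _ (combination≈0 i)) ⟩
      β * - L i             ≈⟨ -‿distribʳ-* β (L i) ⟨
      - (β * L i)           ≈⟨ -‿distribˡ-* β (L i) ⟩
      - β * L i             ≈⟨ lincomb-scale (- β) (tail c) vs i ⟨
      lincomb (λ j → - β * c (suc j)) vs i ∎

    c₀≈0 : c zero ≈ 0#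
    c₀≈0 = decidable-stable (c zero ≈? 0#) λ c₀≉0 →
      let (β , c₀β≈1) = inverse (c zero) c₀≉0
      in v∉span (_ , solve-for-v (trans (*-comm β (c zero)) c₀β≈1))

    rest≈0 : L ≈ᵥ 0ᵥ
    rest≈0 i = begin
      L i                   ≈⟨ +-identityˡ (L i) ⟨
      0# + L i              ≈⟨ +-congʳ (trans (*-congʳ c₀≈0) (zeroˡ (v i))) ⟨
      c zero * v i + L i    ≈⟨ combination≈0 i ⟩
      0#                    ∎

  module _ {n : ℕ} (U : Pred {n}) where

    extend-to-basis : ∀ fuel {k} (vs : Vector Vect k) → n < fuel ℕ.+ k →
                      (∀ j → U (vs j)) → Independent vs → ¬ ¬ (∃[ d ] HasDim U d)
    extend-to-basis zero vs n<k _ ind = contradiction (independent⇒≤ vs ind) (ℕ.<⇒≱ n<k)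
    extend-to-basis (suc fuel) {k} vs n<fuel+k members ind no-basis =
      ¬¬-excluded-middle {A = ∃[ v ] (U v × ¬ Span vs v)} λ where
      (yes (v , Uv , v∉span)) →
        extend-to-basis fuel (v ∷ vs) (≡.subst (n <_) (≡.sym (ℕ.+-suc fuel k)) n<fuel+k)
                        (λ { zero → Uv ; (suc j) → members j }) (independent-∷ v vs v∉span ind) no-basis
      (no nothing-new) → no-basis (k , vs , record
        { members     = members
        ; independent = ind
        ; spanning    = λ v Uv → decidable-stable (span? vs v) (λ v∉span → nothing-new (v , Uv , v∉span))
        })

    basis-exists : ¬ ¬ (∃[ d ] HasDim U d)
    basis-exists = extend-to-basis (suc n) (λ ()) (s≤s (ℕ.m≤m+n n 0)) (λ ()) (λ _ _ ())

  lincomb∈ : ∀ {n k} (U : Subspace {n}) (c : Vector Carrier k) {vs : Vector Vect k} →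
             (∀ j → carrier U (vs j)) → carrier U (lincomb c vs)
  lincomb∈ {k = zero}  U c _       = has-zero U
  lincomb∈ {k = suc k} U c members =
    closed-+ U (closed-· U (c zero) (members zero)) (lincomb∈ U (tail c) (members ∘ suc))

  dim-0⇒trivial : ∀ {n} {P : Pred {n}} → HasDim P 0 → ∀ {v} → P v → v ≈ᵥ 0ᵥ
  dim-0⇒trivial (_ , basis) {v} Pv = proj₂ (IsBasis.spanning basis v Pv)

  module _ {n : ℕ} (U W : Subspace {n}) where

    ++-isBasis : (∀ {v} → carrier U v → carrier W v → v ≈ᵥ 0ᵥ) →
                 ∀ {a b} {us : Vector Vect a} {ws : Vector Vect b} →
                 IsBasis (carrier U) us → IsBasis (carrier W) ws →
                 IsBasis (carrier U +ₚ carrier W) (us ++ ws)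
    ++-isBasis trivial {a} {b} {us} {ws} basisU basisW = record
      { members     = members
      ; independent = independent
      ; spanning    = spanning
      }
      where
      module BU = IsBasis basisU
      module BW = IsBasis basisW

      members : ∀ i → (carrier U +ₚ carrier W) ((us ++ ws) i)
      members = ∀-splitAt a
        (λ j → ≡.subst (carrier U +ₚ carrier W) (≡.sym (lookup-++ˡ us ws j))
                 (us j , 0ᵥ , BU.members j , has-zero W , λ i → sym (+-identityʳ (us j i))))
        (λ j → ≡.subst (carrier U +ₚ carrier W) (≡.sym (lookup-++ʳ us ws j))
                 (0ᵥ , ws j , has-zero U , BW.members j , λ i → sym (+-identityˡ (ws j i))))

      independent : Independent (us ++ ws)
      independent c combination≈0 =
        ∀-splitAt a (BU.independent (c ∘ (_↑ˡ b)) left≈0) (BW.independent (c ∘ (a ↑ʳ_)) right≈0)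
        where
        left right : Vect
        left  = lincomb (c ∘ (_↑ˡ b)) us
        right = lincomb (c ∘ (a ↑ʳ_)) ws

        left+right≈0 : ∀ i → left i + right i ≈ 0#
        left+right≈0 i = trans (sym (lincomb-++ c us ws i)) (combination≈0 i)

        left∈W : carrier W left
        left∈W = resp W (λ i → trans (-1*x≈-x (right i)) (sym (+-inverseˡ-unique _ _ (left+right≈0 i))))
                        (closed-· W (- 1#) (lincomb∈ W _ BW.members))

        left≈0 : left ≈ᵥ 0ᵥ
        left≈0 = trivial (lincomb∈ U _ BU.members) left∈W

        right≈0 : right ≈ᵥ 0ᵥ
        right≈0 i = begin
          right i           ≈⟨ +-identityˡ (right i) ⟨
          0# + right i      ≈⟨ +-congʳ (left≈0 i) ⟨
          left i + right i  ≈⟨ left+right≈0 i ⟩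
          0#                ∎

      spanning : ∀ v → (carrier U +ₚ carrier W) v → Span (us ++ ws) v
      spanning v (u , w , Uu , Ww , v≈u+w) with BU.spanning u Uu | BW.spanning w Ww
      ... | cu , u≈ | cw , w≈ = cu ++ cw , λ i → begin
        v i
          ≈⟨ trans (v≈u+w i) (+-cong (u≈ i) (w≈ i)) ⟩
        lincomb cu us i + lincomb cw ws i
          ≈⟨ +-cong (lincomb-congˡ us (λ j → reflexive (lookup-++ˡ cu cw j)) i)
                    (lincomb-congˡ ws (λ j → reflexive (lookup-++ʳ cu cw j)) i) ⟨
        lincomb ((cu ++ cw) ∘ (_↑ˡ b)) us i + lincomb ((cu ++ cw) ∘ (a ↑ʳ_)) ws i
          ≈⟨ lincomb-++ (cu ++ cw) us ws i ⟨
        lincomb (cu ++ cw) (us ++ ws) i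
          ∎

    module _ (dist : DistAtLeast n U W) where

      dim-∩≡0 : ∀ {s t} → HasDim (carrier U +ₚ carrier W) s → HasDim (carrier U ∩ₚ carrier W) t → t ≡ 0
      dim-∩≡0 {s} {t} (vs , basis) hI =
        ℕ.n≤0⇒n≡0 (ℕ.+-cancelˡ-≤ n t 0 (≡.subst (n ℕ.+ t ≤_) (≡.sym (ℕ.+-identityʳ n))
          (ℕ.≤-trans (dist s t (vs , basis) hI) (independent⇒≤ vs (IsBasis.independent basis)))))

      complementary-dims : ∀ {a b} → HasDim (carrier U) a → HasDim (carrier W) b → ¬ ¬ (a ℕ.+ b ≡ n)
      complementary-dims {a} {b} (us , basisU) (ws , basisW) = do
        s , hS ← basis-exists (carrier U +ₚ carrier W)
        t , hI ← basis-exists (carrier U ∩ₚ carrier W)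
        let hI₀ = ≡.subst (HasDim (carrier U ∩ₚ carrier W)) (dim-∩≡0 hS hI) hI
            basis = ++-isBasis (λ Uv Wv → dim-0⇒trivial hI₀ (Uv , Wv)) basisU basisW
        pure (ℕ.≤-antisym (independent⇒≤ (us ++ ws) (IsBasis.independent basis))
                          (≡.subst (_≤ a ℕ.+ b) (ℕ.+-identityʳ n) (dist (a ℕ.+ b) 0 (us ++ ws , basis) hI₀)))
        where open RawMonad ¬¬-Monad

  at-most-two-codewords : ∀ {n m k} → n ≡ suc (2 ℕ.* k) → SubspaceCode {n} m n → ¬ (2 < m)
  at-most-two-codewords {k = k} n-odd code (s≤s (s≤s (s≤s _))) = (do
      d₀ , h₀ ← basis-exists (carrier w₀)
      d₁ , h₁ ← basis-exists (carrier w₁)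
      d₂ , h₂ ← basis-exists (carrier w₂)
      d₀+d₁≡n ← complementary-dims w₀ w₁ (min-dist zero (suc zero) (λ ())) h₀ h₁
      d₀+d₂≡n ← complementary-dims w₀ w₂ (min-dist zero (suc (suc zero)) (λ ())) h₀ h₂
      d₁+d₂≡n ← complementary-dims w₁ w₂ (min-dist (suc zero) (suc (suc zero)) (λ ())) h₁ h₂
      pure (ℕ.even≢odd d₀ k (≡.trans (pairwise-sums⇒double d₀ d₁ d₂ d₀+d₁≡n d₀+d₂≡n d₁+d₂≡n) n-odd)))
    id
    where
    open SubspaceCode code
    open RawMonad ¬¬-Monad
    w₀ w₁ w₂ : Subspace
    w₀ = word zero
    w₁ = word (suc zero)
    w₂ = word (suc (suc zero))

-- Opened only here: inside the module above, _*_ is the multiplication of F.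
open import Data.Nat using (_*_)

mainTheorem1 : (q : ℕ) → IsPrimePower q → (F : FiniteField q)
    → (n : ℕ) → ∃[ k ] (n ≡ suc (2 * k))
    → (m : ℕ) → LinearAlgebra.SubspaceCode F n m n → m ≤ 2
mainTheorem1 q _ F n (k , n-odd) m code = ℕ.≮⇒≥ (at-most-two-codewords F {k = k} n-odd code)
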